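{- Let $p$ be a UPLang program and let $\mathcal{I}^*$ be the least fixed point of its immediate consequence operator $T_p$. Then $p$ is safe if and only if $p$ is safe under $\mathcal{I}^*$; that is, there exists an interpretation $\mathcal{I}$ such that for every stack $s$ the execution $\delta_{\mathcal{I}}(p,s,\mathsf{emptyHeap})$ does not have first component $\bot(P,\bar v)$ for any $P,\bar v$, if and only if for every stack $s$ the execution $\delta_{\mathcal{I}^*}(p,s,\mathsf{emptyHeap})$ does not have first component $\bot(P,\bar v)$ for any $P,\bar v$.
   Context: UPLang is a deterministic imperative language. Types: $\mathit{Int}$ (interpreted as $\mathbb{Z}$), $\mathit{Addr}$ (interpreted as $\mathbb{N}$), and $\mathit{Obj}$ (a non-recursive algebraic data type of heap objects, containing a distinguished constant $\mathit{defObj}$). A heap is a finite sequence of objects; $\mathsf{emptyHeap}$ is the empty sequence. Heap operations: $\mathsf{allocate}(h,o)=(h\,{+\!\!+}\,[o],\,|h|+1)$; $\mathsf{read}(h,a)=h[a-1]$ if $0<a\le |h|$ and $\mathit{defObj}$ otherwise; $\mathsf{write}(h,a,o)=h[a-1\mapsto o]$ if $0<a\le|h|$ and $h$ otherwise; $\mathbf{null}=0$. Expressions are built from integer constants, variables, unary/binary arithmetic and logical operators ($0$ is false, nonzero true), $\mathbf{null}$, $\mathbf{defObj}$, and ADT constructors/selectors/testers. Statements: $x:=e$; $p:=\mathbf{alloc}(e)$; $x:=\mathbf{read}(p)$; $\mathbf{write}(p,e)$; $\mathbf{skip}$; $S_1;S_2$; $\mathbf{if}\ e\ \mathbf{then}\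 \{S_1\}\ \mathbf{else}\ \{S_2\}$; $\mathbf{while}\ e\ \mathbf{do}\ \{S\}$; $\mathbf{assume}(e)$; $\mathbf{assert}(e)$; $\mathbf{assume}(P(e_1,\dots,e_n))$; $\mathbf{assert}(P(e_1,\dots,e_n))$ with $P$ an uninterpreted predicate symbol. An interpretation $\mathcal{I}$ maps each predicate symbol of arity $n$ to a set of $n$-tuples of values of the argument types; $\mathcal{I}_1\sqsubseteq\mathcal{I}_2$ iff $\mathcal{I}_1(P)\subseteq\mathcal{I}_2(P)$ for all $P$. A stack maps variables to values; $[\![e]\!]_s$ is the value of $e$ in $s$. The partial big-step semantics $\delta_{\mathcal{I}}(S,s,h)\in\{\top,\bot(P,\bar v)\}\times\mathit{Stack}\times\mathit{Heap}$: assignment, allocation, read and write update the stack/heap with the heap operations above (allocation stores the new address, read stores $\mathsf{read}(h,s(p))$) and yield $\top$; $\mathbf{skip}$ yields $(\top,s,h)$; sequencing and loops propagate failures and continue on $\top$; $\mathbf{if}$/$\mathbf{while}$ treat guard value $0$ as false; loops that do not terminate are undefined; $\mathbf{assume}(e)$ is undefined if $[\![e]\!]_s=0$, else $(\top,s,h)$; $\mathbf{assume}(P(\bar e))$ is undefined if the argument values are not in $\mathcal{I}(P)$, else $(\top,s,h)$; $\mathbf{assert}(e)$ yields $(\bot(F,()),s,h)$ if $[\![e]\!]_s=0$ ($F$ a special $0$-ary symbol), else $(\top,s,h)$; $\mathbf{assert}(P(\bar e))$ yields $(\bot(P,\bar v),s,h)$ where $\bar v$ are the argument values if $\bar v\notin\mathcal{I}(P)$,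 else $(\top,s,h)$. The immediate consequence operator is $T_p(\mathcal{I})(r)=\mathcal{I}(r)\cup\{\bar v\mid\exists s.\ \text{the first component of }\delta_{\mathcal{I}}(p,s,\mathsf{emptyHeap})\text{ is }\bot(r,\bar v)\}$; $T_p$ is monotone and $\mathcal{I}^*$ denotes its least fixed point (the limit of iterating $T_p$ from the interpretation assigning $\emptyset$ to every predicate). A program $p$ is safe if there exists an interpretation $\mathcal{I}$ such that for every stack $s$, $\delta_{\mathcal{I}}(p,s,\mathsf{emptyHeap})$ does not result in $\bot(P,\bar v)$ for any $P,\bar v$ (undefined executions count as not failing). -}

module Defs where

open import Level using (Level) renaming (suc to lsuc; zero to lzero)
open import Data.Nat as ℕ using (ℕ; zero; suc)
open import Data.Integer as ℤ using (ℤ; +_; 0ℤ; 1ℤ)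
open import Data.Fin as Fin using (Fin)
open import Data.List as List using (List; []; _∷_; _++_; [_]; length)
open import Data.List.Relation.Unary.All as All using (All; []; _∷_)
open import Data.List.Membership.Propositional using (_∈_)
open import Data.Product using (Σ; ∃; ∃-syntax; _×_; _,_; proj₁; proj₂)
open import Data.Sum using (_⊎_)
open import Data.Bool using (Bool; true; false; if_then_else_)
open import Relation.Nullary using (¬_; Dec; yes; no; does)
open import Relation.Binary.PropositionalEquality using (_≡_; _≢_; refl)
open import Function.Bundles using (_⇔_)

data BTy : Set where
  bint baddr : BTy

⟦_⟧B : BTy → Set
⟦ bint ⟧B  = ℤ
⟦ baddr ⟧B = ℕ

-- Signature of the heap-object ADT Obj: finitely many constructors, each
-- with a list of Int/Addr fields (non-recursive), and a distinguished
-- constant defObj.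
record Sig : Set where
  field
    nCtor  : ℕ
    fields : Fin nCtor → List BTy
    defObj : Σ (Fin nCtor) (λ c → All ⟦_⟧B (fields c))

data Ty : Set where
  int addr obj : Ty

base : BTy → Ty
base bint  = int
base baddr = addr

_≟Ty_ : (a b : Ty) → Dec (a ≡ b)
int  ≟Ty int  = yes refl
int  ≟Ty addr = no λ ()
int  ≟Ty obj  = no λ ()
addr ≟Ty int  = no λ ()
addr ≟Ty addr = yes refl
addr ≟Ty obj  = no λ ()
obj  ≟Ty int  = no λ ()
obj  ≟Ty addr = no λ ()
obj  ≟Ty obj  = yes refl

-- integer operators (0 is false, nonzero is true)
data UnOp : Set where
  neg lnot : UnOp

data BinOp : Set where
  add sub mul eq lt le land lor : BinOp

bool→ℤ : Bool → ℤ
bool→ℤ true  = 1ℤ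
bool→ℤ false = 0ℤ

truthy : ℤ → Bool
truthy (+ zero) = false
truthy _        = true

evalUn : UnOp → ℤ → ℤ
evalUn neg  x = ℤ.- x
evalUn lnot x = bool→ℤ (Data.Bool.not (truthy x))

evalBin : BinOp → ℤ → ℤ → ℤ
evalBin add  x y = x ℤ.+ y
evalBin sub  x y = x ℤ.- y
evalBin mul  x y = x ℤ.* y
evalBin eq   x y = bool→ℤ (does (x ℤ.≟ y))
evalBin lt   x y = bool→ℤ (does (x ℤ.<? y))
evalBin le   x y = bool→ℤ (does (x ℤ.≤? y))
evalBin land x y = bool→ℤ (truthy x Data.Bool.∧ truthy y)
evalBin lor  x y = bool→ℤ (truthy x Data.Bool.∨ truthy y)

record PredSym : Set where
  constructor psym
  field
    name  : ℕ
    arity : List Ty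

module UPLang (sg : Sig) where
  open Sig sg using (nCtor; fields)

  Obj : Set
  Obj = Σ (Fin nCtor) (λ c → All ⟦_⟧B (fields c))

  defObj : Obj
  defObj = Sig.defObj sg

  ⟦_⟧ : Ty → Set
  ⟦ int ⟧  = ℤ
  ⟦ addr ⟧ = ℕ
  ⟦ obj ⟧  = Obj

  Heap : Set
  Heap = List Obj

  emptyHeap : Heap
  emptyHeap = []

  allocate : Heap → Obj → Heap × ℕ
  allocate h o = (h ++ [ o ]) , suc (length h)

  -- read h a = h[a-1] if 0 < a ≤ |h|, defObj otherwise
  readH : Heap → ℕ → Obj
  readH h       zero          = defObj
  readH []      (suc a)       = defObj
  readH (o ∷ h) (suc zero)    = o
  readH (o ∷ h) (suc (suc a)) = readH h (suc a)

  -- write h a o = h[a-1 ↦ o] if 0 < a ≤ |h|, h otherwise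
  writeH : Heap → ℕ → Obj → Heap
  writeH h        zero          o = h
  writeH []       (suc a)       o = []
  writeH (o' ∷ h) (suc zero)    o = o ∷ h
  writeH (o' ∷ h) (suc (suc a)) o = o' ∷ writeH h (suc a) o

  nullA : ℕ
  nullA = 0

  -- Stacks: variables are natural-number names, one namespace per type.
  Stack : Set
  Stack = (τ : Ty) → ℕ → ⟦ τ ⟧

  update : Stack → (τ : Ty) → ℕ → ⟦ τ ⟧ → Stack
  update s τ x v τ' y with τ ≟Ty τ' | x ℕ.≟ y
  ... | yes refl | yes refl = v
  ... | _        | _        = s τ' y

  data Exp : Ty → Set where
    const  : ℤ → Exp int
    var    : (τ : Ty) → ℕ → Exp τ
    unop   : UnOp → Exp int → Exp int
    binop  : BinOp → Exp int → Exp int → Exp int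
    eqAddr : Exp addr → Exp addr → Exp int
    null   : Exp addr
    defObjE : Exp obj
    mk     : (c : Fin nCtor) → All (λ b → Exp (base b)) (fields c) → Exp obj
    sel    : (c : Fin nCtor) {b : BTy} → b ∈ fields c → Exp obj → Exp (base b)
    is     : (c : Fin nCtor) → Exp obj → Exp int

  defaultB : (b : BTy) → ⟦ base b ⟧
  defaultB bint  = 0ℤ
  defaultB baddr = 0

  toB : (b : BTy) → ⟦ b ⟧B → ⟦ base b ⟧
  toB bint  v = v
  toB baddr v = v

  select : (c : Fin nCtor) {b : BTy} → b ∈ fields c → Obj → ⟦ base b ⟧
  select c {b} i (c' , vs) with c' Fin.≟ c
  ... | yes refl = toB b (All.lookup vs i)
  ... | no _     = defaultB b

  mutual
    eval : Stack → {τ : Ty} → Exp τ → ⟦ τ ⟧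
    eval s (const z)       = z
    eval s (var τ x)       = s τ x
    eval s (unop o e)      = evalUn o (eval s e)
    eval s (binop o e₁ e₂) = evalBin o (eval s e₁) (eval s e₂)
    eval s (eqAddr e₁ e₂)  = bool→ℤ (does (eval s e₁ ℕ.≟ eval s e₂))
    eval s null            = nullA
    eval s defObjE         = defObj
    eval s (mk c es)       = c , evalFields s es
    eval s (sel c i e)     = select c i (eval s e)
    eval s (is c e)        = bool→ℤ (does (proj₁ (eval s e) Fin.≟ c))

    evalFields : Stack → {bs : List BTy} → All (λ b → Exp (base b)) bs → All ⟦_⟧B bs
    evalFields s {[]}         []       = []
    evalFields s {bint ∷ bs}  (e ∷ es) = eval s e ∷ evalFields s es
    evalFields s {baddr ∷ bs} (e ∷ es) = eval s e ∷ evalFields s es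

  evalArgs : Stack → {τs : List Ty} → All Exp τs → All ⟦_⟧ τs
  evalArgs s []       = []
  evalArgs s (e ∷ es) = eval s e ∷ evalArgs s es

  Tuple : PredSym → Set
  Tuple P = All ⟦_⟧ (PredSym.arity P)

  data Stmt : Set where
    assign  : {τ : Ty} → ℕ → Exp τ → Stmt
    alloc   : ℕ → Exp obj → Stmt                   -- p := alloc(e)  (p an Addr variable)
    read    : ℕ → ℕ → Stmt                         -- x := read(p)   (x Obj var, p Addr var)
    write   : ℕ → Exp obj → Stmt
    skip    : Stmt
    _⨾_     : Stmt → Stmt → Stmt
    ifte    : Exp int → Stmt → Stmt → Stmt
    while   : Exp int → Stmt → Stmt
    assume  : Exp int → Stmt
    assert  : Exp int → Stmt
    assumeP : (P : PredSym) → All Exp (PredSym.arity P) → Stmt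
    assertP : (P : PredSym) → All Exp (PredSym.arity P) → Stmt

  Interp : Set₁
  Interp = (P : PredSym) → Tuple P → Set

  _⊑_ : Interp → Interp → Set
  I₁ ⊑ I₂ = ∀ P v → I₁ P v → I₂ P v

  -- Failure labels: the special 0-ary symbol F, or P(v̄)
  data Failure : Set where
    F    : Failure
    atom : (P : PredSym) → Tuple P → Failure

  data Result : Set where
    ⊤r : Result
    ⊥r : Failure → Result

  -- Partial big-step semantics δ_I as a (deterministic) relation:
  -- Exec I S s h r s' h'  means  δ_I(S,s,h) = (r,s',h').
  -- No derivation = undefined.
  data Exec (I : Interp) : Stmt → Stack → Heap → Result → Stack → Heap → Set where
    e-assign : ∀ {τ x} {e : Exp τ} {s h} →
      Exec I (assign x e) s h ⊤r (update s τ x (eval s e)) h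
    e-alloc : ∀ {p e s h} →
      Exec I (alloc p e) s h ⊤r
        (update s addr p (proj₂ (allocate h (eval s e)))) (proj₁ (allocate h (eval s e)))
    e-read : ∀ {x p s h} →
      Exec I (read x p) s h ⊤r (update s obj x (readH h (s addr p))) h
    e-write : ∀ {p e s h} →
      Exec I (write p e) s h ⊤r s (writeH h (s addr p) (eval s e))
    e-skip : ∀ {s h} → Exec I skip s h ⊤r s h
    e-seq-⊤ : ∀ {S₁ S₂ s h s₁ h₁ r s₂ h₂} →
      Exec I S₁ s h ⊤r s₁ h₁ → Exec I S₂ s₁ h₁ r s₂ h₂ →
      Exec I (S₁ ⨾ S₂) s h r s₂ h₂
    e-seq-⊥ : ∀ {S₁ S₂ s h f s₁ h₁} →
      Exec I S₁ s h (⊥r f) s₁ h₁ →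
      Exec I (S₁ ⨾ S₂) s h (⊥r f) s₁ h₁
    e-if-t : ∀ {e S₁ S₂ s h r s' h'} → eval s e ≢ 0ℤ →
      Exec I S₁ s h r s' h' → Exec I (ifte e S₁ S₂) s h r s' h'
    e-if-f : ∀ {e S₁ S₂ s h r s' h'} → eval s e ≡ 0ℤ →
      Exec I S₂ s h r s' h' → Exec I (ifte e S₁ S₂) s h r s' h'
    e-while-f : ∀ {e S s h} → eval s e ≡ 0ℤ →
      Exec I (while e S) s h ⊤r s h
    e-while-⊤ : ∀ {e S s h s₁ h₁ r s₂ h₂} → eval s e ≢ 0ℤ →
      Exec I S s h ⊤r s₁ h₁ → Exec I (while e S) s₁ h₁ r s₂ h₂ →
      Exec I (while e S) s h r s₂ h₂
    e-while-⊥ : ∀ {e S s h f s₁ h₁} → eval s e ≢ 0ℤ →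
      Exec I S s h (⊥r f) s₁ h₁ →
      Exec I (while e S) s h (⊥r f) s₁ h₁
    e-assume : ∀ {e s h} → eval s e ≢ 0ℤ → Exec I (assume e) s h ⊤r s h
    e-assert-⊤ : ∀ {e s h} → eval s e ≢ 0ℤ → Exec I (assert e) s h ⊤r s h
    e-assert-⊥ : ∀ {e s h} → eval s e ≡ 0ℤ → Exec I (assert e) s h (⊥r F) s h
    e-assumeP : ∀ {P es s h} → I P (evalArgs s es) →
      Exec I (assumeP P es) s h ⊤r s h
    e-assertP-⊤ : ∀ {P es s h} → I P (evalArgs s es) →
      Exec I (assertP P es) s h ⊤r s h
    e-assertP-⊥ : ∀ {P es s h} → ¬ I P (evalArgs s es) →
      Exec I (assertP P es) s h (⊥r (atom P (evalArgs s es))) s h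

  T : Stmt → Interp → Interp
  T p I P v = I P v ⊎ ∃[ s ] ∃[ s' ] ∃[ h' ] Exec I p s emptyHeap (⊥r (atom P v)) s' h'

  IsLeastFixedPoint : (Interp → Interp) → Interp → Set₁
  IsLeastFixedPoint Φ I =
    (Φ I ⊑ I × I ⊑ Φ I) × (∀ J → (Φ J ⊑ J × J ⊑ Φ J) → I ⊑ J)

  SafeUnder : Interp → Stmt → Set
  SafeUnder I p = ∀ s → ¬ (∃[ f ] ∃[ s' ] ∃[ h' ] Exec I p s emptyHeap (⊥r f) s' h')

  Safe : Stmt → Set₁
  Safe p = ∃[ I ] SafeUnder I p

{-# OPTIONS --safe #-}
module Submission where

-- If p is safe under I, then T_p adds nothing to I, so I is a fixed point and
-- I* ⊑ I. Enlarging the interpretation preserves every execution except those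
-- ending in a failed assertP, so a failure of the assertion F under I* would
-- also occur under I. A failure ⊥(P, v̄) under I* is impossible outright: it
-- puts v̄ into T_p(I*) = I*, while the failing assertP requires v̄ ∉ I*(P).

open import Defs
open import Data.Empty using (⊥-elim)
open import Data.Product using (_×_; _,_)
open import Data.Sum using (inj₁; inj₂)
open import Function.Bundles using (_⇔_; mk⇔)
open import Relation.Nullary using (¬_)

module _ {sg : Sig} where
  open UPLang sg

  IsFixedPoint : (Interp → Interp) → Interp → Set
  IsFixedPoint Φ I = Φ I ⊑ I × I ⊑ Φ I

  data NonAtomic : Result → Set where
    ⊤r : NonAtomic ⊤r
    F  : NonAtomic (⊥r F)

  exec-atom⇒¬I : ∀ {I S s h P v s' h'} →
    Exec I S s h (⊥r (atom P v)) s' h' → ¬ I P v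
  exec-atom⇒¬I (e-seq-⊤ _ ex)     = exec-atom⇒¬I ex
  exec-atom⇒¬I (e-seq-⊥ ex)       = exec-atom⇒¬I ex
  exec-atom⇒¬I (e-if-t _ ex)      = exec-atom⇒¬I ex
  exec-atom⇒¬I (e-if-f _ ex)      = exec-atom⇒¬I ex
  exec-atom⇒¬I (e-while-⊤ _ _ ex) = exec-atom⇒¬I ex
  exec-atom⇒¬I (e-while-⊥ _ ex)   = exec-atom⇒¬I ex
  exec-atom⇒¬I (e-assertP-⊥ v∉I)  = v∉I

  -- The interpretation is consulted negatively only by a failing assertP,
  -- which ends the execution with an atomic failure.
  exec-mono : ∀ {J I S s h r s' h'} → J ⊑ I → NonAtomic r →
    Exec J S s h r s' h' → Exec I S s h r s' h'
  exec-mono J⊑I _  e-assign               = e-assign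
  exec-mono J⊑I _  e-alloc                = e-alloc
  exec-mono J⊑I _  e-read                 = e-read
  exec-mono J⊑I _  e-write                = e-write
  exec-mono J⊑I _  e-skip                 = e-skip
  exec-mono J⊑I na (e-seq-⊤ ex₁ ex₂)      = e-seq-⊤ (exec-mono J⊑I ⊤r ex₁) (exec-mono J⊑I na ex₂)
  exec-mono J⊑I na (e-seq-⊥ ex)           = e-seq-⊥ (exec-mono J⊑I na ex)
  exec-mono J⊑I na (e-if-t e≢0 ex)        = e-if-t e≢0 (exec-mono J⊑I na ex)
  exec-mono J⊑I na (e-if-f e≡0 ex)        = e-if-f e≡0 (exec-mono J⊑I na ex)
  exec-mono J⊑I _  (e-while-f e≡0)        = e-while-f e≡0
  exec-mono J⊑I na (e-while-⊤ e≢0 ex₁ ex₂) =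
    e-while-⊤ e≢0 (exec-mono J⊑I ⊤r ex₁) (exec-mono J⊑I na ex₂)
  exec-mono J⊑I na (e-while-⊥ e≢0 ex)     = e-while-⊥ e≢0 (exec-mono J⊑I na ex)
  exec-mono J⊑I _  (e-assume e≢0)         = e-assume e≢0
  exec-mono J⊑I _  (e-assert-⊤ e≢0)       = e-assert-⊤ e≢0
  exec-mono J⊑I _  (e-assert-⊥ e≡0)       = e-assert-⊥ e≡0
  exec-mono J⊑I _  (e-assumeP v∈J)        = e-assumeP (J⊑I _ _ v∈J)
  exec-mono J⊑I _  (e-assertP-⊤ v∈J)      = e-assertP-⊤ (J⊑I _ _ v∈J)

  safeUnder⇒fixedPoint : ∀ {I p} → SafeUnder I p → IsFixedPoint (T p) I
  safeUnder⇒fixedPoint {I} {p} safe = T⊑I , λ _ _ → inj₁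
    where
    T⊑I : T p I ⊑ I
    T⊑I P v (inj₁ v∈I)                = v∈I
    T⊑I P v (inj₂ (s , s' , h' , ex)) = ⊥-elim (safe s (atom P v , s' , h' , ex))

  prefixedPoint⇒¬exec-atom : ∀ {I p s P v s' h'} → T p I ⊑ I →
    ¬ Exec I p s emptyHeap (⊥r (atom P v)) s' h'
  prefixedPoint⇒¬exec-atom T⊑I ex = exec-atom⇒¬I ex (T⊑I _ _ (inj₂ (_ , _ , _ , ex)))

  safe⇒safeUnder-lfp : ∀ {p I*} → IsLeastFixedPoint (T p) I* → Safe p → SafeUnder I* p
  safe⇒safeUnder-lfp (_ , least) (I , safe) s (F , s' , h' , ex) =
    safe s (F , s' , h' , exec-mono (least I (safeUnder⇒fixedPoint safe)) F ex)
  safe⇒safeUnder-lfp ((T⊑I* , _) , _) _ _ (atom _ _ , _ , _ , ex) =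
    prefixedPoint⇒¬exec-atom T⊑I* ex

lemma3p6 : (sg : Sig) → let open UPLang sg in
    (p : Stmt) (I* : Interp) → IsLeastFixedPoint (T p) I* →
    Safe p ⇔ SafeUnder I* p
lemma3p6 sg p I* lfp = mk⇔ (safe⇒safeUnder-lfp lfp) (λ safe* → I* , safe*)
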